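{- Let $\mathcal{P}$ be a one-dimensional pattern with weights in which at least one weight is nonzero, and let $\mathbf{w}:\mathbb{Z}\to A$ be a bi-infinite word over an alphabet $A$ which is a finite subset of $\mathbb{C}$. Suppose there exists a constant $C\in\mathbb{C}$ such that \[\sum_{(x,g_x)\in F}\mathbf{w}(x)\,g_x=C\quad\text{for every figure with weights } F\in\mathcal{P}.\] Then $\mathbf{w}$ is periodic, i.e. there exists an integer $p\neq 0$ with $\mathbf{w}(i+p)=\mathbf{w}(i)$ for all $i\in\mathbb{Z}$.
   Context: A figure with weights in $\mathbb{Z}^n$ is a finite set $F^w=\{(u,g_u): u\in F, g_u\in\mathbb{Z}\}$ where $F\subset\mathbb{Z}^n$ is finite; $g_u$ is the weight of $u$. Two figures with weights are equivalent if one is obtained from the other by an integer translation of the points, keeping the weights. A pattern with weights is an equivalence class of figures with weights under this relation (i.e. the set of all integer translates of a fixed figure with weights). Here $n=1$. -}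

module Defs where

open import Level using (Level; _⊔_) renaming (suc to lsuc)
open import Data.Nat using (ℕ; zero; suc)
open import Data.Integer using (ℤ; +_; -[1+_])
open import Data.Product using (Σ; _×_; _,_; proj₁; proj₂; ∃)
open import Data.List using (List; map; foldr)
open import Data.List.Relation.Unary.Any using (Any)
open import Data.List.Relation.Unary.Unique.Propositional using (Unique)
open import Relation.Binary.PropositionalEquality using (_≡_)
open import Relation.Nullary using (¬_)
open import Algebra.Bundles using (CommutativeRing)

module _ {c ℓ : Level} (R : CommutativeRing c ℓ) where
  open CommutativeRing R

  natR : ℕ → Carrier
  natR zero    = 0#
  natR (suc n) = 1# + natR n

  intR : ℤ → Carrier
  intR (+ n)      = natR n
  intR -[1+ n ]   = - natR (suc n)

-- A field of characteristic zero (abstracting ℂ, which the stdlib lacks).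
record CharZeroField (c ℓ : Level) : Set (lsuc (c ⊔ ℓ)) where
  field
    cring    : CommutativeRing c ℓ
  open CommutativeRing cring
  field
    0≉1      : ¬ (0# ≈ 1#)
    inverse  : ∀ x → ¬ (x ≈ 0#) → Σ Carrier λ y → (x * y) ≈ 1#
    charZero : ∀ n → natR cring n ≈ 0# → n ≡ 0

-- A one-dimensional figure with weights: a finite list of (point, weight)
-- pairs whose points are pairwise distinct (so it is a finite set F ⊂ ℤ with
-- one weight g_u per u ∈ F).
Figure : Set
Figure = List (ℤ × ℤ)

DistinctPoints : Figure → Set
DistinctPoints F = Unique (map proj₁ F)

HasNonzeroWeight : Figure → Set
HasNonzeroWeight F = Any (λ p → ¬ (proj₂ p ≡ + 0)) F

-- Translate of a figure by t (weights kept); the pattern P of F is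
-- { translate t F | t ∈ ℤ }.
translate : ℤ → Figure → Figure
translate t = map (λ p → (proj₁ p Data.Integer.+ t , proj₂ p))

InPattern : Figure → Figure → Set
InPattern F G = ∃ λ t → G ≡ translate t F

module _ {c ℓ : Level} (R : CommutativeRing c ℓ) where
  open CommutativeRing R

  weightedSum : (ℤ → Carrier) → Figure → Carrier
  weightedSum w G = foldr (λ p acc → (w (proj₁ p) * intR R (proj₂ p)) + acc) 0# G

module _ {c ℓ : Level} (K : CharZeroField c ℓ) where
  Elt : Set c
  Elt = CommutativeRing.Carrier (CharZeroField.cring K)

  Eq : Elt → Elt → Set ℓ
  Eq = CommutativeRing._≈_ (CharZeroField.cring K)

  wsum : (ℤ → Elt) → Figure → Elt
  wsum = weightedSum (CharZeroField.cring K)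

-- Let M and m be the largest and smallest points of nonzero weight of F, and L = M − m.
-- If all translates of F have the same weighted sum, then for every p the difference
-- d(i) = w(i + p) − w(i) has weighted sum 0 on every translate: it satisfies a linear
-- recurrence whose extreme coefficients g_M and g_m are nonzero. In characteristic 0
-- these can be divided out, so d is determined by any L + 1 consecutive values, both
-- forwards and backwards. As A is finite, two of the first |A|^(L+1) + 1 windows of
-- length L + 1 of w coincide, at positions s < s'; for p = s' − s, d vanishes on a
-- window and hence everywhere.
module Submission where

open import Defs
open import Data.Integer using (ℤ; +_; _+_)
open import Data.Product using (Σ; _×_)
open import Data.List using (List)
open import Data.List.Relation.Unary.Any using (Any)
open import Relation.Binary.PropositionalEquality using (_≡_)
open import Relation.Nullary using (¬_)

open import Level using (Level; _⊔_)
open import Function using (_∘_; id)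
open import Data.Nat as ℕ using (ℕ; zero; suc; _∸_; _^_; s≤s; z≤n)
import Data.Nat.Properties as ℕ
open import Data.Integer as ℤ using (-[1+_]; _-_; -_; ∣_∣)
import Data.Integer.Properties as ℤ
open import Data.Integer.Tactic.RingSolver using (solve-∀)
open import Data.Fin as Fin using (Fin; toℕ; combine)
import Data.Fin.Properties as Fin
open import Data.Product using (_,_; proj₁; proj₂; ∃; ∃₂)
open import Data.Sum using (_⊎_; inj₁; inj₂; [_,_]′)
open import Data.List using ([]; _∷_; map; filter; length; lookup)
open import Data.List.Relation.Unary.Any as Any using (here; there)
import Data.List.Relation.Unary.Any.Properties as Any
open import Data.List.Relation.Unary.All as All using (All; _∷_)
import Data.List.Relation.Unary.All.Properties as All
open import Data.List.Relation.Unary.AllPairs using (_∷_)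
open import Data.List.Membership.Propositional using (_∈_; find)
open import Data.List.Membership.Propositional.Properties using (∈-map∘filter⁺; ∈-map∘filter⁻)
import Data.List.Extrema as Extrema
open import Algebra.Bundles using (CommutativeRing)
import Algebra.Properties.Group as GroupProperties
import Algebra.Properties.AbelianGroup as AbelianGroupProperties
import Algebra.Properties.Ring as RingProperties
import Algebra.Properties.CommutativeSemigroup as CommutativeSemigroupProperties
open import Relation.Binary.Bundles using (Setoid; TotalOrder)
open import Relation.Binary.Properties.TotalOrder ℤ.≤-totalOrder using (≥-totalOrder)
open import Relation.Binary.PropositionalEquality as ≡ using (refl; sym; trans; cong; cong₂; subst; subst₂)
open import Relation.Nullary using (Dec; yes; no; ¬?)

window-induction : ∀ {p} (L : ℕ) (Q : ℕ → Set p) →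
  (∀ k → k ℕ.< suc L → Q k) →
  (∀ n → (∀ k → k ℕ.< L → Q (n ℕ.+ k)) → Q (n ℕ.+ L)) →
  ∀ n → Q n
window-induction L Q initial step n = subst Q (ℕ.+-identityʳ n) (window n 0 (s≤s z≤n))
  where
  window : ∀ n k → k ℕ.< suc L → Q (n ℕ.+ k)
  window zero    k k≤L = initial k k≤L
  window (suc n) k k≤L with ℕ.m<1+n⇒m<n∨m≡n k≤L
  ... | inj₁ k<L  = subst Q (ℕ.+-suc n k) (window n (suc k) (s≤s k<L))
  ... | inj₂ refl = step (suc n) λ k k<L → subst Q (ℕ.+-suc n k) (window n (suc k) (s≤s k<L))

i+[j-i]≡j : ∀ i j → i + (j - i) ≡ j
i+[j-i]≡j = solve-∀

[i+j]-[j+k]≡i-k : ∀ i j k → (i + j) - (j + k) ≡ i - k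
[i+j]-[j+k]≡i-k = solve-∀

[i+[j+k]]-k≡i+j : ∀ i j k → (i + (j + k)) - k ≡ i + j
[i+[j+k]]-k≡i+j = solve-∀

i-[j+k]≡[i-j]-k : ∀ i j k → i - (j + k) ≡ (i - j) - k
i-[j+k]≡[i-j]-k = solve-∀

i+[j-k]≡j+[i-k] : ∀ i j k → i + (j - k) ≡ j + (i - k)
i+[j-k]≡j+[i-k] = solve-∀

i+[j-k]≡j-[k-i] : ∀ i j k → i + (j - k) ≡ j - (k - i)
i+[j-k]≡j-[k-i] = solve-∀

[i+k]+[j-i]≡j+k : ∀ i j k → (i + k) + (j - i) ≡ j + k
[i+k]+[j-i]≡j+k = solve-∀

natural-offset : ∀ {y L} → + 0 ℤ.≤ y → y ℤ.< + L → ∃ λ k → k ℕ.< L × y ≡ + k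
natural-offset {+ k} _ k<L = k , ℤ.drop‿+<+ k<L , refl

ℤ-split : ∀ s L i → (∃ λ n → s + + n ≡ i) ⊎ (∃ λ n → (s + + L) - + n ≡ i)
ℤ-split s L i with i - s in i-s≡
... | + n      = inj₁ (n , trans (cong (λ x → s + x) (sym i-s≡)) (i+[j-i]≡j s i))
... | -[1+ n ] = inj₂ (L ℕ.+ suc n , (begin
  (s + + L) - (+ L + + suc n) ≡⟨ [i+j]-[j+k]≡i-k s (+ L) (+ suc n) ⟩
  s + -[1+ n ]                ≡⟨ cong (λ x → s + x) (sym i-s≡) ⟩
  s + (i - s)                 ≡⟨ i+[j-i]≡j s i ⟩
  i                           ∎))
  where open ≡.≡-Reasoning

window-induction-upward : ∀ {p} (L : ℕ) (P : ℤ → Set p) (s : ℤ) →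
  (∀ k → k ℕ.< suc L → P (s + + k)) →
  (∀ j → (∀ k → k ℕ.< L → P (j + + k)) → P (j + + L)) →
  ∀ n → P (s + + n)
window-induction-upward L P s initial step = window-induction L (λ n → P (s + + n)) initial λ n H →
  subst P (ℤ.+-assoc s (+ n) (+ L))
    (step (s + + n) λ k k<L → subst P (sym (ℤ.+-assoc s (+ n) (+ k))) (H k k<L))

window-induction-downward : ∀ {p} (L : ℕ) (P : ℤ → Set p) (e : ℤ) →
  (∀ k → k ℕ.< suc L → P (e - + k)) →
  (∀ j → (∀ k → k ℕ.< L → P (j - + k)) → P (j - + L)) →
  ∀ n → P (e - + n)
window-induction-downward L P e initial step = window-induction L (λ n → P (e - + n)) initial λ n H →
  subst P (sym (i-[j+k]≡[i-j]-k e (+ n) (+ L)))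
    (step (e - + n) λ k k<L → subst P (i-[j+k]≡[i-j]-k e (+ n) (+ k)) (H k k<L))

ℤ-window-induction : ∀ {p} (L : ℕ) (P : ℤ → Set p) (s : ℤ) →
  (∀ k → k ℕ.< suc L → P (s + + k)) →
  (∀ j → (∀ k → k ℕ.< L → P (j + + k)) → P (j + + L)) →
  (∀ j → (∀ k → k ℕ.< L → P (j - + k)) → P (j - + L)) →
  ∀ i → P i
ℤ-window-induction L P s initial stepʳ stepˡ i =
  [ (λ (n , s+n≡i) → subst P s+n≡i (upward n)) , (λ (n , e-n≡i) → subst P e-n≡i (downward n)) ]′
  (ℤ-split s L i)
  where
  upward : ∀ n → P (s + + n)
  upward = window-induction-upward L P s initial stepʳ

  downward : ∀ n → P ((s + + L) - + n)
  downward = window-induction-downward L P (s + + L) (λ k k<1+L →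
    subst (λ l → P ((s + + l) - + k)) (ℕ.m∸n+n≡m (ℕ.m<1+n⇒m≤n k<1+L))
      (subst P (sym ([i+[j+k]]-k≡i+j s (+ (L ∸ k)) (+ k))) (upward (L ∸ k))))
    stepˡ

nonzero-weight? : (p : ℤ × ℤ) → Dec (¬ proj₂ p ≡ + 0)
nonzero-weight? p = ¬? (proj₂ p ℤ.≟ + 0)

support : Figure → List ℤ
support F = map proj₁ (filter nonzero-weight? F)

∈-support⁺ : ∀ {F x g} → (x , g) ∈ F → ¬ g ≡ + 0 → x ∈ support F
∈-support⁺ xg∈F g≢0 = ∈-map∘filter⁺ proj₁ nonzero-weight? (_ , xg∈F , refl , g≢0)

∈-support⁻ : ∀ {F x} → x ∈ support F → ∃ λ g → (x , g) ∈ F × ¬ g ≡ + 0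
∈-support⁻ x∈ with ∈-map∘filter⁻ proj₁ nonzero-weight? x∈
... | (_ , g) , xg∈F , refl , g≢0 = g , xg∈F , g≢0

module _ {c ℓ : Level} (R : CommutativeRing c ℓ) where
  open CommutativeRing R renaming (_+_ to _⊕_; _-_ to _⊖_; -_ to ⊝_; refl to ≈-refl; sym to ≈-sym; trans to ≈-trans)
  open import Relation.Binary.Reasoning.Setoid setoid
  open RingProperties ring using (-‿distribˡ-*)
  open AbelianGroupProperties +-abelianGroup using (⁻¹-∙-comm)
  open CommutativeSemigroupProperties +-commutativeSemigroup using (interchange)

  weightedSum-translate : ∀ w t F → weightedSum R w (translate t F) ≡ weightedSum R (λ x → w (x + t)) F
  weightedSum-translate w t []      = refl
  weightedSum-translate w t (p ∷ F) = cong (w (proj₁ p + t) * intR R (proj₂ p) ⊕_) (weightedSum-translate w t F)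

  weightedSum-cong : ∀ {u v} → (∀ x → u x ≈ v x) → ∀ F → weightedSum R u F ≈ weightedSum R v F
  weightedSum-cong u≈v []      = ≈-refl
  weightedSum-cong u≈v (p ∷ F) = +-cong (*-congʳ (u≈v (proj₁ p))) (weightedSum-cong u≈v F)

  weightedSum-sub : ∀ u v F → weightedSum R (λ x → u x ⊖ v x) F ≈ weightedSum R u F ⊖ weightedSum R v F
  weightedSum-sub u v []      = ≈-sym (-‿inverseʳ 0#)
  weightedSum-sub u v ((x , g) ∷ F) = begin
    (u x ⊖ v x) * intR R g ⊕ weightedSum R (λ x → u x ⊖ v x) F
      ≈⟨ +-cong (distribʳ _ _ _) (weightedSum-sub u v F) ⟩
    (u x * intR R g ⊕ (⊝ v x) * intR R g) ⊕ (weightedSum R u F ⊖ weightedSum R v F)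
      ≈⟨ interchange _ _ _ _ ⟩
    (u x * intR R g ⊕ weightedSum R u F) ⊕ ((⊝ v x) * intR R g ⊕ ⊝ weightedSum R v F)
      ≈⟨ +-congˡ (≈-trans (+-congʳ (≈-sym (-‿distribˡ-* _ _))) (⁻¹-∙-comm _ _)) ⟩
    (u x * intR R g ⊕ weightedSum R u F) ⊖ (v x * intR R g ⊕ weightedSum R v F) ∎

  weightedSum-vanishing : ∀ w F → (∀ {x g} → (x , g) ∈ F → w x * intR R g ≈ 0#) → weightedSum R w F ≈ 0#
  weightedSum-vanishing w []      vanish = ≈-refl
  weightedSum-vanishing w (p ∷ F) vanish =
    ≈-trans (+-cong (vanish (here refl)) (weightedSum-vanishing w F (vanish ∘ there))) (+-identityˡ 0#)

  weightedSum-concentrated : ∀ w F {X g} → DistinctPoints F → (X , g) ∈ F →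
    (∀ {x h} → (x , h) ∈ F → ¬ x ≡ X → w x * intR R h ≈ 0#) →
    weightedSum R w F ≈ w X * intR R g
  weightedSum-concentrated w (_ ∷ F) (X∉F ∷ _) (here refl) vanish =
    ≈-trans (+-congˡ (weightedSum-vanishing w F λ x∈F → vanish (there x∈F)
                       λ x≡X → All.lookup (All.map⁻ X∉F) x∈F (sym x≡X)))
            (+-identityʳ _)
  weightedSum-concentrated w (_ ∷ F) (x∉F ∷ distinct) (there X∈F) vanish =
    ≈-trans (+-cong (vanish (here refl) λ x≡X → All.lookup (All.map⁻ x∉F) X∈F x≡X)
                    (weightedSum-concentrated w F distinct X∈F (vanish ∘ there)))
            (+-identityˡ _)

  Annihilates : Figure → (ℤ → Carrier) → Set ℓ
  Annihilates F d = ∀ t → weightedSum R (λ x → d (x + t)) F ≈ 0#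

  shift-difference-annihilated : ∀ w F C → (∀ t → weightedSum R w (translate t F) ≈ C) →
    ∀ p → Annihilates F (λ i → w (i + p) ⊖ w i)
  shift-difference-annihilated w F C sums p t = begin
    weightedSum R (λ x → w ((x + t) + p) ⊖ w (x + t)) F
      ≈⟨ weightedSum-sub (λ x → w ((x + t) + p)) (λ x → w (x + t)) F ⟩
    weightedSum R (λ x → w ((x + t) + p)) F ⊖ weightedSum R (λ x → w (x + t)) F
      ≈⟨ +-congʳ (weightedSum-cong (λ x → reflexive (cong w (ℤ.+-assoc x t p))) F) ⟩
    weightedSum R (λ x → w (x + (t + p))) F ⊖ weightedSum R (λ x → w (x + t)) F
      ≡⟨ sym (cong₂ _⊖_ (weightedSum-translate w (t + p) F) (weightedSum-translate w t F)) ⟩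
    weightedSum R w (translate (t + p) F) ⊖ weightedSum R w (translate t F)
      ≈⟨ +-cong (sums (t + p)) (-‿cong (sums t)) ⟩
    C ⊖ C
      ≈⟨ -‿inverseʳ C ⟩
    0# ∎

support-nonempty : ∀ {F} → HasNonzeroWeight F → ∃ λ x → x ∈ support F
support-nonempty nonzero with (x , g) , xg∈F , g≢0 ← find nonzero = x , ∈-support⁺ xg∈F g≢0

module _ {a ℓ₁ ℓ₂} (O : TotalOrder a ℓ₁ ℓ₂) where
  open TotalOrder O
  open Extrema O using (max; argmax-sel; ⊥≤max; xs≤max)

  ∃-maximum : ∀ {x xs} → x ∈ xs → ∃ λ y → y ∈ xs × All (_≤ y) xs
  ∃-maximum {xs = z ∷ zs} _ = max z zs , max∈ , ⊥≤max z zs ∷ xs≤max z zs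
    where
    max∈ : max z zs ∈ z ∷ zs
    max∈ with argmax-sel id z zs
    ... | inj₁ max≡z  = here max≡z
    ... | inj₂ max∈zs = there max∈zs

module _ {a ℓ} (S : Setoid a ℓ) where
  open Setoid S renaming (refl to ≈-refl; sym to ≈-sym; trans to ≈-trans)

  repeated-window : (A : List Carrier) (f : ℕ → Carrier) → (∀ n → Any (f n ≈_) A) →
    ∀ n → ∃₂ λ s s' → s ℕ.< s' × (∀ k → k ℕ.< n → f (s ℕ.+ k) ≈ f (s' ℕ.+ k))
  repeated-window A f f∈A n =
    let i , j , i<j , same = Fin.pigeonhole (ℕ.n<1+n _) (λ i → word n (toℕ i))
    in toℕ i , toℕ j , i<j , word-injective n (toℕ i) (toℕ j) same
    where
    letter : ℕ → Fin (length A)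
    letter s = Any.index (f∈A s)

    word : ∀ n → ℕ → Fin (length A ^ n)
    word zero    s = Fin.zero
    word (suc n) s = combine (letter s) (word n (suc s))

    letter-injective : ∀ s s' → letter s ≡ letter s' → f s ≈ f s'
    letter-injective s s' same = ≈-trans (Any.lookup-index (f∈A s))
      (≈-sym (subst (λ i → f s' ≈ lookup A i) (sym same) (Any.lookup-index (f∈A s'))))

    word-injective : ∀ n s s' → word n s ≡ word n s' → ∀ k → k ℕ.< n → f (s ℕ.+ k) ≈ f (s' ℕ.+ k)
    word-injective (suc n) s s' same zero _ =
      subst₂ (λ x y → f x ≈ f y) (sym (ℕ.+-identityʳ s)) (sym (ℕ.+-identityʳ s'))
        (letter-injective s s' (proj₁ (Fin.combine-injective (letter s) _ (letter s') _ same)))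
    word-injective (suc n) s s' same (suc k) (s≤s k<n) =
      subst₂ (λ x y → f x ≈ f y) (sym (ℕ.+-suc s k)) (sym (ℕ.+-suc s' k))
        (word-injective n (suc s) (suc s') (proj₂ (Fin.combine-injective (letter s) _ (letter s') _ same)) k k<n)

module _ {c ℓ : Level} (K : CharZeroField c ℓ) where
  open CharZeroField K
  open CommutativeRing cring renaming (_+_ to _⊕_; _-_ to _⊖_; -_ to ⊝_; refl to ≈-refl; sym to ≈-sym; trans to ≈-trans)
  open import Relation.Binary.Reasoning.Setoid setoid
  open GroupProperties +-group using (⁻¹-injective; ε⁻¹≈ε; x∙y⁻¹≈ε⇒x≈y; x≈y⇒x∙y⁻¹≈ε)

  intR-≉0 : ∀ g → ¬ g ≡ + 0 → ¬ intR cring g ≈ 0#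
  intR-≉0 (+ zero)  g≢0 _ = g≢0 refl
  intR-≉0 (+ suc n) _ n≈0 = ℕ.1+n≢0 (charZero (suc n) n≈0)
  intR-≉0 -[1+ n ]  _ -n≈0 = ℕ.1+n≢0 (charZero (suc n) (⁻¹-injective (≈-trans -n≈0 (≈-sym ε⁻¹≈ε))))

  x*y≈0∧y≉0⇒x≈0 : ∀ a b → a * b ≈ 0# → ¬ b ≈ 0# → a ≈ 0#
  x*y≈0∧y≉0⇒x≈0 a b ab≈0 b≉0 with b⁻¹ , bb⁻¹≈1 ← inverse b b≉0 = begin
    a              ≈⟨ *-identityʳ a ⟨
    a * 1#         ≈⟨ *-congˡ bb⁻¹≈1 ⟨
    a * (b * b⁻¹)  ≈⟨ *-assoc a b b⁻¹ ⟨
    (a * b) * b⁻¹  ≈⟨ *-congʳ ab≈0 ⟩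
    0# * b⁻¹       ≈⟨ zeroˡ b⁻¹ ⟩
    0#             ∎

  annihilated-at : ∀ {F} d → DistinctPoints F → Annihilates cring F d → ∀ {X} → X ∈ support F → ∀ t →
    (∀ {x} → x ∈ support F → ¬ x ≡ X → d (x + t) ≈ 0#) → d (X + t) ≈ 0#
  annihilated-at {F} d distinct annihilates {X} X∈ t others
    with g , Xg∈F , g≢0 ← ∈-support⁻ X∈ =
    x*y≈0∧y≉0⇒x≈0 _ _
      (≈-trans (≈-sym (weightedSum-concentrated cring (λ x → d (x + t)) F distinct Xg∈F vanish)) (annihilates t))
      (intR-≉0 g g≢0)
    where
    vanish : ∀ {x h} → (x , h) ∈ F → ¬ x ≡ X → d (x + t) * intR cring h ≈ 0#
    vanish {h = h} xh∈F x≢X with h ℤ.≟ + 0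
    ... | yes refl = zeroʳ _
    ... | no h≢0   = ≈-trans (*-congʳ (others (∈-support⁺ xh∈F h≢0) x≢X)) (zeroˡ _)

  WindowDetermines : Figure → ℕ → Set (c ⊔ ℓ)
  WindowDetermines F L =
    ∀ d → Annihilates cring F d → ∀ s → (∀ k → k ℕ.< suc L → d (s + + k) ≈ 0#) → ∀ i → d i ≈ 0#

  recurrence-order : ∀ F → DistinctPoints F → HasNonzeroWeight F → ∃ (WindowDetermines F)
  recurrence-order F distinct nonzero
    with _ , x₀∈ ← support-nonempty nonzero
    with M , M∈ , ≤M ← ∃-maximum ℤ.≤-totalOrder x₀∈
    with m , m∈ , m≤ ← ∃-maximum ≥-totalOrder x₀∈
    = L , λ d annihilates s initial →
      ℤ-window-induction L (λ i → d i ≈ 0#) s initial (upward d annihilates) (downward d annihilates)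
    where
    L : ℕ
    L = ∣ M - m ∣

    M-m≡L : M - m ≡ + L
    M-m≡L = sym (ℤ.0≤i⇒+∣i∣≡i (ℤ.i≤j⇒0≤j-i (All.lookup m≤ M∈)))

    -- Translating F so that M (resp. m) lands on j puts every other point of nonzero
    -- weight among the L positions just below (resp. above) j.
    upward : ∀ d → Annihilates cring F d → ∀ j → (∀ k → k ℕ.< L → d (j + + k) ≈ 0#) → d (j + + L) ≈ 0#
    upward d annihilates j H =
      subst (λ i → d i ≈ 0#) (trans (i+[j-k]≡j+[i-k] M j m) (cong (λ y → j + y) M-m≡L))
        (annihilated-at d distinct annihilates M∈ (j - m) λ {x} x∈ x≢M →
          let k , k<L , x-m≡k = natural-offset (ℤ.i≤j⇒0≤j-i (All.lookup m≤ x∈))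
                (subst (x - m ℤ.<_) M-m≡L (ℤ.+-monoˡ-< (- m) (ℤ.≤∧≢⇒< (All.lookup ≤M x∈) x≢M)))
          in subst (λ i → d i ≈ 0#) (sym (trans (i+[j-k]≡j+[i-k] x j m) (cong (λ y → j + y) x-m≡k))) (H k k<L))

    downward : ∀ d → Annihilates cring F d → ∀ j → (∀ k → k ℕ.< L → d (j - + k) ≈ 0#) → d (j - + L) ≈ 0#
    downward d annihilates j H =
      subst (λ i → d i ≈ 0#) (trans (i+[j-k]≡j-[k-i] m j M) (cong (λ y → j - y) M-m≡L))
        (annihilated-at d distinct annihilates m∈ (j - M) λ {x} x∈ x≢m →
          let k , k<L , M-x≡k = natural-offset (ℤ.i≤j⇒0≤j-i (All.lookup ≤M x∈))
                (subst (M - x ℤ.<_) M-m≡L (ℤ.+-monoʳ-< M (ℤ.neg-mono-< (ℤ.≤∧≢⇒< (All.lookup m≤ x∈) (x≢m ∘ sym)))))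
          in subst (λ i → d i ≈ 0#) (sym (trans (i+[j-k]≡j-[k-i] x j M) (cong (λ y → j - y) M-x≡k))) (H k k<L))


  equal-windows⇒periodic : ∀ F {L} → WindowDetermines F L → ∀ w C →
    (∀ t → weightedSum cring w (translate t F) ≈ C) →
    ∀ s s' → (∀ k → k ℕ.< suc L → w (s + + k) ≈ w (s' + + k)) → ∀ i → w (i + (s' - s)) ≈ w i
  equal-windows⇒periodic F {L} determined w C sums s s' same i =
    x∙y⁻¹≈ε⇒x≈y _ _ (determined (λ i → w (i + (s' - s)) ⊖ w i)
      (shift-difference-annihilated cring w F C sums (s' - s)) s initial i)
    where
    initial : ∀ k → k ℕ.< suc L → w ((s + + k) + (s' - s)) ⊖ w (s + + k) ≈ 0#
    initial k k≤L = x≈y⇒x∙y⁻¹≈ε (≈-trans (reflexive (cong w ([i+k]+[j-i]≡j+k s s' (+ k)))) (≈-sym (same k k≤L)))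

m<n⇒n-m≢0 : ∀ {m n} → m ℕ.< n → ¬ + n - + m ≡ + 0
m<n⇒n-m≢0 {m} {n} m<n n-m≡0 = ℕ.<-irrefl (sym (ℤ.+-injective (ℤ.i-j≡0⇒i≡j (+ n) (+ m) n-m≡0))) m<n

proposition1 : ∀ {c ℓ} (K : CharZeroField c ℓ) →
    (F : Figure) → DistinctPoints F → HasNonzeroWeight F →
    (A : List (Elt K)) (w : ℤ → Elt K) → (∀ i → Any (Eq K (w i)) A) →
    (C : Elt K) → (∀ G → InPattern F G → Eq K (wsum K w G) C) →
    Σ ℤ (λ p → ¬ (p ≡ + 0) × (∀ i → Eq K (w (i + p)) (w i)))
proposition1 K F distinct nonzero A w w∈A C sums =
  let L , determined = recurrence-order K F distinct nonzero
      s , s' , s<s' , same = repeated-window setoid A (λ n → w (+ n)) (λ n → w∈A (+ n)) (suc L)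
  in + s' - + s , m<n⇒n-m≢0 s<s' ,
     equal-windows⇒periodic K F determined w C (λ t → sums (translate t F) (t , refl)) (+ s) (+ s') same
  where open CommutativeRing (CharZeroField.cring K) using (setoid)
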